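{- Let $A_1\to A_2\to A_3\to\cdots$ be ring homomorphisms such that the induced maps $A_1/pA_1\to A_2/pA_2\to A_3/pA_3\to\cdots$ are injective, and such that each $A_n$ is $p$-torsion free, $p$-adically separated, and totally integrally closed in $A_n[1/p]$. Then $A=\varinjlim A_n$ is $p$-torsion free and totally integrally closed in $A[1/p]$.
   Context: $p$ is a prime. A subring $A$ of a ring $B$ is totally integrally closed in $B$ if every $b\in B$ such that $\{b^n:n\in\mathbb N\}$ is contained in a finitely generated $A$-submodule of $B$ lies in $A$. -}

module Defs where

open import Level using (Level; _⊔_)
open import Data.Nat using (ℕ; zero; suc; _≤′_; ≤′-reflexive; ≤′-step)
  renaming (_+_ to _+ℕ_; _⊔_ to _⊔ℕ_)
open import Data.Nat.Properties using (m≤m⊔n; m≤n⊔m; ≤⇒≤′)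
open import Data.Fin using (Fin)
import Data.Fin as Fin
open import Data.Product using (Σ; ∃; _×_; _,_)
open import Relation.Binary.PropositionalEquality using (refl)
open import Algebra.Bundles using (CommutativeRing)
open import Algebra.Bundles.Raw using (RawRing)
open import Algebra.Morphism.Structures using (module RingMorphisms)

private variable c ℓ : Level

module _ (R : RawRing c ℓ) where
  open RawRing R

  natR : ℕ → Carrier
  natR zero    = 0#
  natR (suc n) = 1# + natR n

  pow : Carrier → ℕ → Carrier
  pow x zero    = 1#
  pow x (suc n) = x * pow x n

  sumFin : (r : ℕ) → (Fin r → Carrier) → Carrier
  sumFin zero    v = 0#
  sumFin (suc r) v = v Fin.zero + sumFin r (λ i → v (Fin.suc i))

module _ (p : ℕ) (R : RawRing c ℓ) where
  open RawRing R

  p^ : ℕ → Carrier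
  p^ n = pow R (natR R p) n

  PTorsionFree : Set (c ⊔ ℓ)
  PTorsionFree = ∀ a → natR R p * a ≈ 0# → a ≈ 0#

  PAdicallySeparated : Set (c ⊔ ℓ)
  PAdicallySeparated = ∀ a → (∀ n → ∃ λ b → a ≈ p^ n * b) → a ≈ 0#

  _≡[modp]_ : Carrier → Carrier → Set (c ⊔ ℓ)
  x ≡[modp] y = ∃ λ z → x ≈ y + natR R p * z

  -- The localization R[1/p], built as a raw ring:
  -- (a , k) represents a / p^k, and
  -- a/p^k = b/p^l  iff  p^m p^l a = p^m p^k b  for some m.
  Invp : RawRing c ℓ
  Invp = record
    { Carrier = Carrier × ℕ
    ; _≈_ = λ { (a , k) (b , l) → ∃ λ m → p^ m * (p^ l * a) ≈ p^ m * (p^ k * b) }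
    ; _+_ = λ { (a , k) (b , l) → (p^ l * a + p^ k * b , k +ℕ l) }
    ; _*_ = λ { (a , k) (b , l) → (a * b , k +ℕ l) }
    ; -_  = λ { (a , k) → (- a , k) }
    ; 0#  = (0# , 0)
    ; 1#  = (1# , 0)
    }

  toInvp : Carrier → RawRing.Carrier Invp
  toInvp a = (a , 0)

-- A (identified with its image under ι : A → B) is totally integrally
-- closed in B if every b ∈ B such that {b^n : n ∈ ℕ} is contained in a
-- finitely generated A-submodule of B (the one generated by g 0 … g (r-1))
-- lies in A.

TotallyIntegrallyClosedIn : ∀ {a ℓa b ℓb} (A : RawRing a ℓa) (B : RawRing b ℓb)
  → (RawRing.Carrier A → RawRing.Carrier B) → Set _
TotallyIntegrallyClosedIn A B ι =
  ∀ (x : B.Carrier)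
  → (∃ λ (r : ℕ) → Σ (Fin r → B.Carrier) λ g →
       ∀ n → ∃ λ (coef : Fin r → A.Carrier) →
         pow B x n B.≈ sumFin B r (λ i → ι (coef i) B.* g i))
  → ∃ λ (y : A.Carrier) → ι y B.≈ x
  where
  module A = RawRing A
  module B = RawRing B

module DirectSystem (A : ℕ → CommutativeRing c ℓ)
                    (f : ∀ n → CommutativeRing.Carrier (A n) → CommutativeRing.Carrier (A (suc n))) where

  rawA : ℕ → RawRing c ℓ
  rawA n = CommutativeRing.rawRing (A n)

  Car : ℕ → Set c
  Car n = CommutativeRing.Carrier (A n)

  up : ∀ {m n} → m ≤′ n → Car m → Car n
  up (≤′-reflexive refl) x = x
  up (≤′-step q)         x = f _ (up q x)

  private
    l : ∀ m n → m ≤′ m ⊔ℕ n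
    l m n = ≤⇒≤′ (m≤m⊔n m n)
    r : ∀ m n → n ≤′ m ⊔ℕ n
    r m n = ≤⇒≤′ (m≤n⊔m m n)

  -- The direct limit  lim→ A_n  (as elements (n , a) with a ∈ A_n,
  -- identified when they become equal at some later stage).
  colim : RawRing c ℓ
  colim = record
    { Carrier = Σ ℕ Car
    ; _≈_ = λ { (m , x) (n , y) → ∃ λ k → Σ (m ≤′ k) λ q → Σ (n ≤′ k) λ q′ →
                   CommutativeRing._≈_ (A k) (up q x) (up q′ y) }
    ; _+_ = λ { (m , x) (n , y) → (m ⊔ℕ n , CommutativeRing._+_ (A (m ⊔ℕ n)) (up (l m n) x) (up (r m n) y)) }
    ; _*_ = λ { (m , x) (n , y) → (m ⊔ℕ n , CommutativeRing._*_ (A (m ⊔ℕ n)) (up (l m n) x) (up (r m n) y)) }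
    ; -_  = λ { (m , x) → (m , CommutativeRing.-_ (A m) x) }
    ; 0#  = (0 , CommutativeRing.0# (A 0))
    ; 1#  = (0 , CommutativeRing.1# (A 0))
    }

  IsRingHom : ∀ n → Set (c ⊔ ℓ)
  IsRingHom n = RingMorphisms.IsRingHomomorphism (rawA n) (rawA (suc n)) (f n)

module Submission where

-- Let A = lim→ A_n.  Every element of A or of A[1/p] comes from some stage
-- A_m, and an equation in A holds at some later stage.
--
-- * p-torsion freeness: if p·a = 0 in A then p·a = 0 in some A_t, so a = 0
--   in A_t by torsion freeness of A_t, hence a = 0 in A.
-- * total integral closedness: write x = a/p^k with a ∈ A_m and suppose the
--   powers x^n lie in the A-module spanned by g_1, …, g_r ∈ A[1/p].  Clearing
--   the denominators of the g_i (of total exponent D) gives p^D a^n ∈ p^{nk} A,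
--   hence p^D a^n ∈ p^{nk} A_t at a late stage t (cancelling the extra powers
--   of p by torsion freeness).  Since A_n/p → A_{n+1}/p is injective and the
--   A_n are p-torsion free, divisibility by p^j descends along the transition
--   maps, so p^D a^n ∈ p^{nk} A_m.  Thus every x^n lies in A_m·(1/p^D), so
--   x ∈ A_m by total integral closedness of A_m, and hence x ∈ A.

open import Defs
open import Level using (Level)
open import Data.Nat using (ℕ; zero; suc; _≤′_; ≤′-reflexive; ≤′-refl; ≤′-step; _⊔_)
  renaming (_+_ to _+ℕ_; _*_ to _*ℕ_)
open import Data.Nat.Properties
  using (≡-irrelevant; ≤′⇒≤; ≤⇒≤′; ≤′-trans; z≤′n; m≤m⊔n; m≤n⊔m; ⊔-lub; n≮n)
  renaming (+-identityʳ to ℕ-+-identityʳ)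
open import Data.Nat.Primality using (Prime)
open import Data.Product using (Σ; ∃; _×_; _,_; proj₁; proj₂)
open import Data.Fin using (Fin)
import Data.Fin as Fin
open import Data.Empty using (⊥-elim)
open import Function.Base using (_∘_)
open import Relation.Binary.PropositionalEquality as ≡ using (_≡_; subst; subst₂)
open import Algebra.Bundles using (CommutativeRing)
open import Algebra.Bundles.Raw using (RawRing)
open import Algebra.Morphism.Structures using (module RingMorphisms)
import Algebra.Morphism.Construct.Identity as Identity
import Algebra.Morphism.Construct.Composition as Composition
import Algebra.Properties.Ring as RingProperties
import Relation.Binary.Reasoning.Setoid as SetoidReasoning

open RingMorphisms using (IsRingHomomorphism)

-- Proofs of m ≤′ n are unique, so transition maps do not depend on them.
≤′-irrelevant : ∀ {m n} (q q′ : m ≤′ n) → q ≡ q′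
≤′-irrelevant (≤′-reflexive e) (≤′-reflexive e′) = ≡.cong ≤′-reflexive (≡-irrelevant e e′)
≤′-irrelevant ≤′-refl (≤′-step q′)       = ⊥-elim (n≮n _ (≤′⇒≤ q′))
≤′-irrelevant (≤′-step q) ≤′-refl        = ⊥-elim (n≮n _ (≤′⇒≤ q))
≤′-irrelevant (≤′-step q) (≤′-step q′)   = ≡.cong ≤′-step (≤′-irrelevant q q′)

DivisibleByP^ : ∀ {c ℓ} (p : ℕ) (R : RawRing c ℓ) → ℕ → RawRing.Carrier R → Set (c Level.⊔ ℓ)
DivisibleByP^ p R j x = ∃ λ z → x ≈ p^ p R j * z
  where open RawRing R

module TorsionFree {c ℓ} (p : ℕ) (R : CommutativeRing c ℓ)
                   (tf : PTorsionFree p (CommutativeRing.rawRing R)) where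
  open CommutativeRing R
  open RingProperties ring using (x∙y⁻¹≈ε⇒x≈y; x≈y⇒x∙y⁻¹≈ε; x[y-z]≈xy-xz)

  cancel-p : ∀ {u v} → natR rawRing p * u ≈ natR rawRing p * v → u ≈ v
  cancel-p {u} {v} pu≈pv =
    x∙y⁻¹≈ε⇒x≈y u v (tf (u - v) (trans (x[y-z]≈xy-xz _ u v) (x≈y⇒x∙y⁻¹≈ε pu≈pv)))

  cancel-p^ : ∀ M {u v} → p^ p rawRing M * u ≈ p^ p rawRing M * v → u ≈ v
  cancel-p^ zero    {u} {v} e = trans (sym (*-identityˡ u)) (trans e (*-identityˡ v))
  cancel-p^ (suc M) {u} {v} e =
    cancel-p^ M (cancel-p (trans (sym (*-assoc _ _ u)) (trans e (*-assoc _ _ v))))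

module HomomorphicImages {a ℓa c ℓ} {R : RawRing a ℓa} (S : CommutativeRing c ℓ)
    {h : RawRing.Carrier R → CommutativeRing.Carrier S}
    (hom : IsRingHomomorphism R (CommutativeRing.rawRing S) h) where
  open CommutativeRing S
  open IsRingHomomorphism hom

  hom-natR : ∀ k → h (natR R k) ≈ natR rawRing k
  hom-natR zero    = 0#-homo
  hom-natR (suc k) = trans (+-homo _ _) (+-cong 1#-homo (hom-natR k))

totalDen : ∀ r → (Fin r → ℕ) → ℕ
totalDen zero    d = 0
totalDen (suc r) d = d Fin.zero +ℕ totalDen r (d ∘ Fin.suc)

module FractionArithmetic {c ℓ} (p : ℕ) (R : RawRing c ℓ) where
  open RawRing R
  private
    module I = RawRing (Invp p R)
    P^ : ℕ → Carrier
    P^ = p^ p R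

  pow-fraction : ∀ a k n → pow (Invp p R) (a , k) n ≡ (pow R a n , n *ℕ k)
  pow-fraction a k zero    = ≡.refl
  pow-fraction a k (suc n) = ≡.cong ((a , k) I.*_) (pow-fraction a k n)

  den-combination : ∀ r (g : Fin r → I.Carrier) (coef : Fin r → RawRing.Carrier R)
    → proj₂ (sumFin (Invp p R) r (λ i → toInvp p R (coef i) I.* g i)) ≡ totalDen r (proj₂ ∘ g)
  den-combination zero    g coef = ≡.refl
  den-combination (suc r) g coef =
    ≡.cong (proj₂ (g Fin.zero) +ℕ_) (den-combination r (g ∘ Fin.suc) (coef ∘ Fin.suc))

  clear-denominators : ∀ a k n r (g : Fin r → I.Carrier) (coef : Fin r → Carrier)
    → pow (Invp p R) (a , k) n I.≈ sumFin (Invp p R) r (λ i → toInvp p R (coef i) I.* g i)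
    → ∃ λ M → P^ M * (P^ (totalDen r (proj₂ ∘ g)) * pow R a n)
              ≈ P^ M * (P^ (n *ℕ k) * proj₁ (sumFin (Invp p R) r (λ i → toInvp p R (coef i) I.* g i)))
  clear-denominators a k n r g coef (M , E) =
    M , subst₂ (λ d z → P^ M * (P^ d * proj₁ z) ≈ P^ M * (P^ (proj₂ z) * proj₁ combination))
               (den-combination r g coef) (pow-fraction a k n) E
    where
    combination : I.Carrier
    combination = sumFin (Invp p R) r (λ i → toInvp p R (coef i) I.* g i)

module SingleGenerator {c ℓ} (p : ℕ) (R : CommutativeRing c ℓ) where
  open CommutativeRing R
  open SetoidReasoning setoid
  private module I = RawRing (Invp p rawRing)

  multiple-of-1/p^ : ∀ {a b} D L → p^ p rawRing D * a ≈ p^ p rawRing L * b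
    → (a , L) I.≈ sumFin (Invp p rawRing) 1 (λ _ → toInvp p rawRing b I.* (1# , D))
  multiple-of-1/p^ {a} {b} D L e = 0 , (begin
    1# * (P^ (D +ℕ 0) * a)                ≈⟨ *-identityˡ _ ⟩
    P^ (D +ℕ 0) * a                       ≈⟨ *-congʳ (reflexive (≡.cong P^ (ℕ-+-identityʳ D))) ⟩
    P^ D * a                              ≈⟨ e ⟩
    P^ L * b                              ≈⟨ *-congˡ b≈ ⟩
    P^ L * (1# * (b * 1#) + P^ D * 0#)    ≈⟨ sym (*-identityˡ _) ⟩
    1# * (P^ L * (1# * (b * 1#) + P^ D * 0#)) ∎)
    where
    P^ : ℕ → Carrier
    P^ = p^ p rawRing
    b≈ : b ≈ 1# * (b * 1#) + P^ D * 0#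
    b≈ = sym (trans (+-cong (trans (*-identityˡ _) (*-identityʳ b)) (zeroʳ _)) (+-identityʳ b))

module DivisibilityDescent {a ℓa c ℓ} (p : ℕ)
    (R : CommutativeRing a ℓa) (S : CommutativeRing c ℓ)
    {h : CommutativeRing.Carrier R → CommutativeRing.Carrier S}
    (hom : IsRingHomomorphism (CommutativeRing.rawRing R) (CommutativeRing.rawRing S) h)
    (tfS : PTorsionFree p (CommutativeRing.rawRing S))
    (inj-mod-p : ∀ x y → _≡[modp]_ p (CommutativeRing.rawRing S) (h x) (h y)
                       → _≡[modp]_ p (CommutativeRing.rawRing R) x y) where
  private
    module R = CommutativeRing R
    module S = CommutativeRing S
  open IsRingHomomorphism hom
  open HomomorphicImages S hom using (hom-natR)
  open TorsionFree p S tfS using (cancel-p)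

  descend : ∀ j x → DivisibleByP^ p S.rawRing j (h x) → DivisibleByP^ p R.rawRing j x
  descend zero    x _        = x , R.sym (R.*-identityˡ x)
  descend (suc j) x (z , hx≈) = z′ , x≈
    where
    pR : R.Carrier
    pR = natR R.rawRing p
    pS : S.Carrier
    pS = natR S.rawRing p
    w : S.Carrier
    w = p^ p S.rawRing j S.* z

    hx≈pw : h x S.≈ pS S.* w
    hx≈pw = S.trans hx≈ (S.*-assoc _ _ _)

    -- x ≡ 0 (mod p), say x = p x₁ …
    x≡0 : _≡[modp]_ p R.rawRing x R.0#
    x≡0 = inj-mod-p x R.0#
      (w , S.trans hx≈pw (S.sym (S.trans (S.+-congʳ 0#-homo) (S.+-identityˡ _))))
    x₁ : R.Carrier
    x₁ = proj₁ x≡0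
    x≈px₁ : x R.≈ pR R.* x₁
    x≈px₁ = R.trans (proj₂ x≡0) (R.+-identityˡ _)

    -- … then p h(x₁) = h x = p p^j z, so h(x₁) = p^j z …
    hx₁≈ : h x₁ S.≈ p^ p S.rawRing j S.* z
    hx₁≈ = cancel-p (S.trans (S.*-congʳ (S.sym (hom-natR p)))
                     (S.trans (S.sym (*-homo _ _)) (S.trans (⟦⟧-cong (R.sym x≈px₁)) hx≈pw)))

    x₁-divisible : DivisibleByP^ p R.rawRing j x₁
    x₁-divisible = descend j x₁ (z , hx₁≈)
    z′ : R.Carrier
    z′ = proj₁ x₁-divisible
    x≈ : x R.≈ p^ p R.rawRing (suc j) R.* z′
    x≈ = R.trans x≈px₁ (R.trans (R.*-congˡ (proj₂ x₁-divisible)) (R.sym (R.*-assoc _ _ _)))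

module DirectLimit {c ℓ}
    (A : ℕ → CommutativeRing c ℓ)
    (f : ∀ n → CommutativeRing.Carrier (A n) → CommutativeRing.Carrier (A (suc n)))
    (hom : ∀ n → DirectSystem.IsRingHom A f n) where
  open DirectSystem A f public
  module C = RawRing colim
  module Stage (n : ℕ) = CommutativeRing (A n)

  up-hom : ∀ {m n} (q : m ≤′ n) → IsRingHomomorphism (rawA m) (rawA n) (up q)
  up-hom ≤′-refl     = Identity.isRingHomomorphism (rawA _) (Stage.refl _)
  up-hom (≤′-step q) = Composition.isRingHomomorphism (Stage.trans _) (up-hom q) (hom _)

  module Up {m n} (q : m ≤′ n) = IsRingHomomorphism (up-hom q)

  up-∘ : ∀ {i s t} (q : i ≤′ s) (e : s ≤′ t) (q′ : i ≤′ t) x → up e (up q x) ≡ up q′ x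
  up-∘ q e q′ x = ≡.trans (up-trans e) (≡.cong (λ r → up r x) (≤′-irrelevant (≤′-trans q e) q′))
    where
    up-trans : ∀ {t} (e : _ ≤′ t) → up e (up q x) ≡ up (≤′-trans q e) x
    up-trans ≤′-refl = ≡.refl
    up-trans (≤′-step e) = ≡.cong (f _) (up-trans e)

  left : ∀ i j → i ≤′ i ⊔ j
  left i j = ≤⇒≤′ (m≤m⊔n i j)

  right : ∀ i j → j ≤′ i ⊔ j
  right i j = ≤⇒≤′ (m≤n⊔m i j)

  Rep : C.Carrier → (s : ℕ) → Car s → Set ℓ
  Rep (i , x) s v = Σ (i ≤′ s) λ q → Stage._≈_ s (up q x) v

  Rep-incl : ∀ {m s} (q : m ≤′ s) (v : Car m) → Rep (m , v) s (up q v)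
  Rep-incl q v = q , Stage.refl _

  Rep-self : ∀ {m} (v : Car m) → Rep (m , v) m v
  Rep-self = Rep-incl ≤′-refl

  Rep-up : ∀ {X s t v} → Rep X s v → (e : s ≤′ t) → Rep X t (up e v)
  Rep-up {i , x} (q , ex) e =
    ≤′-trans q e , Stage.trans _ (Stage.reflexive _ (≡.sym (up-∘ q e (≤′-trans q e) x))) (Up.⟦⟧-cong e ex)

  ≈-intro : ∀ {X Y s v w} → Rep X s v → Rep Y s w → Stage._≈_ s v w → X C.≈ Y
  ≈-intro {s = s} (q , ex) (q′ , ey) v≈w = s , q , q′ , Stage.trans s ex (Stage.trans s v≈w (Stage.sym s ey))

  ≈-elim : ∀ {X Y} → X C.≈ Y
    → ∃ λ t → ∀ {s v w} → t ≤′ s → Rep X s v → Rep Y s w → Stage._≈_ s v w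
  ≈-elim {i , x} {j , y} (t , a , b , E) = t , agree
    where
    agree : ∀ {s v w} → t ≤′ s → Rep (i , x) s v → Rep (j , y) s w → Stage._≈_ s v w
    agree {s} e (q , ex) (q′ , ey) = begin
      _               ≈⟨ ex ⟨
      up q x          ≈⟨ reflexive (up-∘ a e q x) ⟨
      up e (up a x)   ≈⟨ Up.⟦⟧-cong e E ⟩
      up e (up b y)   ≈⟨ reflexive (up-∘ b e q′ y) ⟩
      up q′ y         ≈⟨ ey ⟩
      _               ∎
      where
      open Stage s
      open SetoidReasoning setoid

  Rep-pair : ∀ {i j s x y v w} → Rep (i , x) s v → Rep (j , y) s w
    → Σ (i ⊔ j ≤′ s) λ q → Stage._≈_ s (up q (up (left i j) x)) v × Stage._≈_ s (up q (up (right i j) y)) w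
  Rep-pair {i} {j} {s} {x} {y} (qx , ex) (qy , ey) =
    q , Stage.trans s (Stage.reflexive s (up-∘ (left i j) q qx x)) ex
      , Stage.trans s (Stage.reflexive s (up-∘ (right i j) q qy y)) ey
    where q = ≤⇒≤′ (⊔-lub (≤′⇒≤ qx) (≤′⇒≤ qy))

  module _ {s : ℕ} where
    open Stage s

    Rep-+ : ∀ {X Y v w} → Rep X s v → Rep Y s w → Rep (X C.+ Y) s (v + w)
    Rep-+ {i , x} {j , y} rx ry with Rep-pair rx ry
    ... | q , ex , ey = q , trans (Up.+-homo q _ _) (+-cong ex ey)

    Rep-* : ∀ {X Y v w} → Rep X s v → Rep Y s w → Rep (X C.* Y) s (v * w)
    Rep-* {i , x} {j , y} rx ry with Rep-pair rx ry
    ... | q , ex , ey = q , trans (Up.*-homo q _ _) (*-cong ex ey)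

    Rep-0 : Rep C.0# s 0#
    Rep-0 = z≤′n , Up.0#-homo z≤′n

    Rep-1 : Rep C.1# s 1#
    Rep-1 = z≤′n , Up.1#-homo z≤′n

    Rep-natR : ∀ k → Rep (natR colim k) s (natR rawRing k)
    Rep-natR zero    = Rep-0
    Rep-natR (suc k) = Rep-+ Rep-1 (Rep-natR k)

    Rep-pow : ∀ {X v} k → Rep X s v → Rep (pow colim X k) s (pow rawRing v k)
    Rep-pow zero    r = Rep-1
    Rep-pow (suc k) r = Rep-* r (Rep-pow k r)

    Rep-p^ : ∀ p k → Rep (p^ p colim k) s (p^ p rawRing k)
    Rep-p^ p k = Rep-pow k (Rep-natR p)

module LimitOfClosedRings {c ℓ} (p : ℕ)
    (A : ℕ → CommutativeRing c ℓ)
    (f : ∀ n → CommutativeRing.Carrier (A n) → CommutativeRing.Carrier (A (suc n)))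
    (hom : ∀ n → DirectSystem.IsRingHom A f n)
    (inj : ∀ n x y → _≡[modp]_ p (DirectSystem.rawA A f (suc n)) (f n x) (f n y)
                   → _≡[modp]_ p (DirectSystem.rawA A f n) x y)
    (tf : ∀ n → PTorsionFree p (DirectSystem.rawA A f n))
    (tic : ∀ n → TotallyIntegrallyClosedIn (DirectSystem.rawA A f n)
                   (Invp p (DirectSystem.rawA A f n)) (toInvp p (DirectSystem.rawA A f n)))
    where
  open DirectLimit A f hom
  private
    Pc : ℕ → C.Carrier
    Pc = p^ p colim
    module IC = RawRing (Invp p colim)

  descend-along : ∀ {m t} (q : m ≤′ t) j x
    → DivisibleByP^ p (rawA t) j (up q x) → DivisibleByP^ p (rawA m) j x
  descend-along ≤′-refl j x d = d
  descend-along (≤′-step q) j x d =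
    descend-along q j x (Step.descend j (up q x) d)
    where
    module Step = DivisibilityDescent p (A _) (A (suc _)) (hom _) (tf (suc _)) (inj _)

  -- If p^M X = p^M p^L Y in the limit and X is represented at stage m by v,
  -- then v is divisible by p^L in A_m: cancel p^M at a late stage, then descend.
  divisible-at-stage : ∀ {m X v} M L Y → Rep X m v
    → Pc M C.* X C.≈ Pc M C.* (Pc L C.* Y) → DivisibleByP^ p (rawA m) L v
  divisible-at-stage {m} {X} {v} M L (j , u) rX E = descend-along q L v (up q′ u , up-v≈)
    where
    t s : ℕ
    t = proj₁ (≈-elim E)
    s = t ⊔ (m ⊔ j)
    q : m ≤′ s
    q = ≤′-trans (left m j) (right t _)
    q′ : j ≤′ s
    q′ = ≤′-trans (right m j) (right t _)
    up-v≈ : Stage._≈_ s (up q v) (Stage._*_ s (p^ p (rawA s) L) (up q′ u))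
    up-v≈ = TorsionFree.cancel-p^ p (A s) (tf s) M
      (proj₂ (≈-elim E) (left t _)
        (Rep-* (Rep-p^ p M) (Rep-up rX q))
        (Rep-* (Rep-p^ p M) (Rep-* (Rep-p^ p L) (Rep-incl q′ u))))

  -- if p·a = 0 in the limit, then p·a = 0 at a late stage s, so a = 0 there
  tf-colim : PTorsionFree p colim
  tf-colim (m , a) pa≈0 = ≈-intro (Rep-incl q a) Rep-0 (tf s (up q a) pa≈0-at-s)
    where
    t s : ℕ
    t = proj₁ (≈-elim pa≈0)
    s = t ⊔ m
    q : m ≤′ s
    q = right t m
    pa≈0-at-s : Stage._≈_ s (Stage._*_ s (natR (rawA s) p) (up q a)) (Stage.0# s)
    pa≈0-at-s = proj₂ (≈-elim pa≈0) (left t m) (Rep-* (Rep-natR p) (Rep-incl q a)) Rep-0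

  toInvp-stage : ∀ {m} a k y → RawRing._≈_ (Invp p (rawA m)) (toInvp p (rawA m) y) (a , k)
    → toInvp p colim (m , y) IC.≈ ((m , a) , k)
  toInvp-stage a k y (M , E) = M ,
    ≈-intro (Rep-* (Rep-p^ p M) (Rep-* (Rep-p^ p k) (Rep-self y)))
            (Rep-* (Rep-p^ p M) (Rep-* (Rep-p^ p 0) (Rep-self a))) E

  numerator-bound : ∀ {m} (a : Car m) k r (g : Fin r → IC.Carrier) n
    → (∃ λ (coef : Fin r → C.Carrier) → pow (Invp p colim) ((m , a) , k) n
          IC.≈ sumFin (Invp p colim) r (λ i → toInvp p colim (coef i) IC.* g i))
    → DivisibleByP^ p (rawA m) (n *ℕ k)
        (Stage._*_ m (p^ p (rawA m) (totalDen r (proj₂ ∘ g))) (pow (rawA m) a n))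
  numerator-bound {m} a k r g n (coef , eq)
    with FractionArithmetic.clear-denominators p colim (m , a) k n r g coef eq
  ... | M , E = divisible-at-stage M (n *ℕ k) _
                  (Rep-* (Rep-p^ p (totalDen r (proj₂ ∘ g))) (Rep-pow n (Rep-self a))) E

  -- By the bound, every power of x = a/p^k is an A_m-multiple of 1/p^D, so x
  -- comes from A_m by total integral closedness of A_m.
  tic-colim : TotallyIntegrallyClosedIn colim (Invp p colim) (toInvp p colim)
  tic-colim ((m , a) , k) (r , g , span) = (m , proj₁ integral) , toInvp-stage a k _ (proj₂ integral)
    where
    module Im = RawRing (Invp p (rawA m))
    D : ℕ
    D = totalDen r (proj₂ ∘ g)
    bound : ∀ n → DivisibleByP^ p (rawA m) (n *ℕ k) (Stage._*_ m (p^ p (rawA m) D) (pow (rawA m) a n))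
    bound n = numerator-bound a k r g n (span n)
    b : ℕ → Car m
    b n = proj₁ (bound n)

    power-in-span : ∀ n → pow (Invp p (rawA m)) (a , k) n
                     Im.≈ sumFin (Invp p (rawA m)) 1 (λ _ → toInvp p (rawA m) (b n) Im.* (Stage.1# m , D))
    power-in-span n = subst (Im._≈ multiple) (≡.sym (FractionArithmetic.pow-fraction p (rawA m) a k n))
      (SingleGenerator.multiple-of-1/p^ p (A m) D (n *ℕ k) (proj₂ (bound n)))
      where
      multiple : Im.Carrier
      multiple = sumFin (Invp p (rawA m)) 1 (λ _ → toInvp p (rawA m) (b n) Im.* (Stage.1# m , D))

    integral : ∃ λ (y : Car m) → toInvp p (rawA m) y Im.≈ (a , k)
    integral = tic m (a , k) (1 , (λ _ → (Stage.1# m , D)) , λ n → (λ _ → b n) , power-in-span n)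

lemma3p2 : ∀ {c ℓ : Level} (p : ℕ) → Prime p
  → (A : ℕ → CommutativeRing c ℓ)
  → (f : ∀ n → CommutativeRing.Carrier (A n) → CommutativeRing.Carrier (A (suc n)))
  → (∀ n → DirectSystem.IsRingHom A f n)
  → (∀ n x y → _≡[modp]_ p (DirectSystem.rawA A f (suc n)) (f n x) (f n y)
              → _≡[modp]_ p (DirectSystem.rawA A f n) x y)
  → (∀ n → PTorsionFree p (DirectSystem.rawA A f n))
  → (∀ n → PAdicallySeparated p (DirectSystem.rawA A f n))
  → (∀ n → TotallyIntegrallyClosedIn (DirectSystem.rawA A f n) (Invp p (DirectSystem.rawA A f n)) (toInvp p (DirectSystem.rawA A f n)))
  → PTorsionFree p (DirectSystem.colim A f)
    × TotallyIntegrallyClosedIn (DirectSystem.colim A f) (Invp p (DirectSystem.colim A f)) (toInvp p (DirectSystem.colim A f))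
lemma3p2 p _ A f hom inj tf _ tic = tf-colim , tic-colim
  where open LimitOfClosedRings p A f hom inj tf tic
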